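{- Consider an execution of Local-Search with precision $\varepsilon>0$ and cardinality $\kappa$ on a ground set $V$, and let $S$ be the current solution at an iteration of the while loop, with $x$ the element selected (so $f(x\mid S)\ge\frac{1+\varepsilon}{\kappa}f(S)$) and $y\in\arg\min_{y\in S}f(y\mid S\setminus\{y\})$. Then $$f((S\cup\{x\})\setminus\{y\})\ge\Big(1+\frac{\varepsilon}{\kappa}\Big)f(S).$$
   Context: $f:2^V\to\mathbb{R}_{\ge0}$ is non-negative, monotone and submodular. Local-Search with precision $\varepsilon$ and cardinality $\kappa$: let $S$ be the output of the greedy algorithm with cardinality $\kappa$ on $V$ ($\kappa$ times add an element of maximum marginal value); while there exists $x\in V$ with $f(x\mid S)\ge\frac{1+\varepsilon}{\kappa}f(S)$: pick such an $x$, pick $y\in\arg\min_{y\in S}f(y\mid S\setminus\{y\})$, and set $S\gets(S\cup\{x\})\setminus\{y\}$. Return $S$.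
   Formalization: The set function f takes values in the non-negative rationals rather than in $\mathbb{R}_{\ge0}$, and the precision ε is rational. -}

module Defs where

open import Data.Nat as ℕ using (ℕ; zero; suc)
open import Data.Integer using (+_)
open import Data.Rational using (ℚ; 0ℚ; 1ℚ; _+_; _-_; _*_; _/_; _≤_; _<_)
open import Data.Fin using (Fin)
open import Data.Fin.Subset using (Subset; ⊥; ⁅_⁆; _∪_; _∩_; _⊆_; _∈_; _∉_) renaming (_-_ to _∖_)
open import Data.Product using (_×_)

-- Ground set V = Fin n; subsets of V are 'Subset n'; set functions take values in ℚ.
SetFn : ℕ → Set
SetFn n = Subset n → ℚ

NonNegative : ∀ {n} → SetFn n → Set
NonNegative {n} f = (A : Subset n) → 0ℚ ≤ f A

Monotone : ∀ {n} → SetFn n → Set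
Monotone {n} f = (A B : Subset n) → A ⊆ B → f A ≤ f B

Submodular : ∀ {n} → SetFn n → Set
Submodular {n} f = (A B : Subset n) → f (A ∪ B) + f (A ∩ B) ≤ f A + f B

marg : ∀ {n} → SetFn n → Fin n → Subset n → ℚ
marg f x S = f (S ∪ ⁅ x ⁆) - f S

toℚ : ℕ → ℚ
toℚ k = (+ k) / 1

-- GreedyRun f k S : S is a possible state of the greedy algorithm after k
-- additions, each adding an element e ∉ S of maximum marginal value over V ∖ S
-- (ties broken arbitrarily).
data GreedyRun {n} (f : SetFn n) : ℕ → Subset n → Set where
  g-start : GreedyRun f zero ⊥
  g-step  : ∀ {k S} (e : Fin n) → GreedyRun f k S → e ∉ S →
            ((z : Fin n) → z ∉ S → marg f z S ≤ marg f e S) →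
            GreedyRun f (suc k) (S ∪ ⁅ e ⁆)

Improving : ∀ {n} (f : SetFn n) (ε : ℚ) (κ : ℕ) .{{_ : ℕ.NonZero κ}} → Fin n → Subset n → Set
Improving f ε κ x S = ((1ℚ + ε) * ((+ 1) / κ)) * f S ≤ marg f x S

IsArgminRemoval : ∀ {n} (f : SetFn n) → Fin n → Subset n → Set
IsArgminRemoval {n} f y S =
  y ∈ S × ((z : Fin n) → z ∈ S → marg f y (S ∖ y) ≤ marg f z (S ∖ z))

-- LSState f ε κ S : S is the current solution at some iteration of Local-Search
-- (precision ε, cardinality κ): either the greedy output, or obtained from a
-- state by one swap of the while loop.
data LSState {n} (f : SetFn n) (ε : ℚ) (κ : ℕ) .{{_ : ℕ.NonZero κ}} : Subset n → Set where
  ls-init : ∀ {S} → GreedyRun f κ S → LSState f ε κ S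
  ls-swap : ∀ {S} (x y : Fin n) → LSState f ε κ S →
            Improving f ε κ x S → IsArgminRemoval f y S →
            LSState f ε κ ((S ∪ ⁅ x ⁆) ∖ y)

{-# OPTIONS --safe #-}
-- Write S′ = (S ∖ y) ∪ {x}. By submodularity the gain of x only grows when y is removed, so
-- f(S′) ≥ f(S) + f(x ∣ S) − f(y ∣ S ∖ y). The removal gains f(z ∣ A ∖ z) also only grow as A
-- shrinks, so removing the elements of S one by one telescopes to |S| · min_z f(z ∣ S ∖ z) ≤ f(S);
-- hence f(y ∣ S ∖ y) ≤ f(S)/κ once |S| ≥ κ, and the improvement condition gives the bound.
-- Along the run |S| ≥ κ holds as long as f(S) > 0, since then the swapped-in x lies outside S.
-- If instead the greedy output has value 0, then so has its first pick, hence every singleton,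
-- hence (by subadditivity) every set, and the bound is trivial.
module Submission where

open import Defs
open import Data.Nat as ℕ using (ℕ)
open import Data.Integer using (+_)
open import Data.Rational using (ℚ; 0ℚ; 1ℚ; _+_; _*_; _/_; _≤_; _<_)
open import Data.Fin using (Fin)
open import Data.Fin.Subset using (Subset; ⁅_⁆; _∪_) renaming (_-_ to _∖_)

open import Data.Nat using (suc; NonZero)
open import Data.Nat.Properties as ℕ using ()
import Data.Nat.Coprimality as Coprime
import Data.Integer as ℤ
import Data.Integer.Properties as ℤ
open import Data.Rational using (_-_; -_; mkℚ; *≤*; nonNegative; positive)
open import Data.Rational.Properties hiding (_≟_)
open import Data.Rational.Solver using (module +-*-Solver)
open import Data.Fin.Subset using (_∩_; _∈_; _∉_; _⊆_; _─_; ⊥; inside; outside; ∣_∣)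
open import Data.Fin.Subset.Properties
open import Data.Fin.Properties using (_≟_)
open import Data.Vec using (_∷_; here; there)
open import Data.Product using (_×_; _,_; proj₁; proj₂)
open import Data.Sum using (_⊎_; inj₁; inj₂; [_,_])
open import Function using (_∘_)
open import Relation.Binary.PropositionalEquality
  using (_≡_; _≢_; refl; sym; trans; cong; subst; subst₂; module ≡-Reasoning)
open import Relation.Nullary using (yes; no; contradiction)
open +-*-Solver using (solve; _:+_; _:-_; :-_; _:*_; _:=_; con)

private
  variable
    n : ℕ
    p q r : Subset n
    x y : Fin n

p≤q⇒0≤q-p : ∀ {p q} → p ≤ q → 0ℚ ≤ q - p
p≤q⇒0≤q-p {p} {q} p≤q = subst (_≤ q - p) (+-inverseʳ p) (+-monoˡ-≤ (- p) p≤q)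

p≤p+q : ∀ p {q} → 0ℚ ≤ q → p ≤ p + q
p≤p+q p {q} 0≤q = subst (_≤ p + q) (+-identityʳ p) (+-monoʳ-≤ p 0≤q)

p-q≤p : ∀ p {q} → 0ℚ ≤ q → p - q ≤ p
p-q≤p p {q} 0≤q = subst (p - q ≤_) (+-identityʳ p) (+-monoʳ-≤ p (neg-antimono-≤ 0≤q))

p-r≤q-r⇒p≤q : ∀ p q r → p - r ≤ q - r → p ≤ q
p-r≤q-r⇒p≤q p q r h = subst₂ _≤_ (cancel p) (cancel q) (+-monoˡ-≤ r h)
  where
  cancel : ∀ s → s - r + r ≡ s
  cancel s = solve 2 (λ s r → s :- r :+ r := s) refl s r

a+d≤c+b⇒a-b≤c-d : ∀ a b c d → a + d ≤ c + b → a - b ≤ c - d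
a+d≤c+b⇒a-b≤c-d a b c d h = subst₂ _≤_
  (solve 4 (λ a b c d → a :+ d :+ (:- b :- d) := a :- b) refl a b c d)
  (solve 4 (λ a b c d → c :+ b :+ (:- b :- d) := c :- d) refl a b c d)
  (+-monoˡ-≤ (- b - d) h)

p≤[1+q]*p : ∀ {p q} → 0ℚ ≤ p → 0ℚ ≤ q → p ≤ (1ℚ + q) * p
p≤[1+q]*p {p} {q} 0≤p 0≤q = subst (p ≤_) (solve 2 (λ p q → p :+ q :* p := (con 1ℚ :+ q) :* p) refl p q)
  (p≤p+q p (nonNegative⁻¹ _ {{nonNeg*nonNeg⇒nonNeg q {{nonNegative 0≤q}} p {{nonNegative 0≤p}}}}))

0<p∧0<q⇒0<p*q : ∀ {p q} → 0ℚ < p → 0ℚ < q → 0ℚ < p * q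
0<p∧0<q⇒0<p*q {p} {q} 0<p 0<q = positive⁻¹ _ {{pos*pos⇒pos p {{positive 0<p}} q {{positive 0<q}}}}

toℚ≡mkℚ : ∀ k → toℚ k ≡ mkℚ (+ k) 0 (Coprime.sym (Coprime.1-coprimeTo k))
toℚ≡mkℚ k = normalize-coprime (Coprime.sym (Coprime.1-coprimeTo k))

toℚ-suc : ∀ k → toℚ (suc k) ≡ 1ℚ + toℚ k
toℚ-suc k rewrite toℚ≡mkℚ k = cong (λ i → (+ 1 ℤ.+ i) / 1) (sym (ℤ.*-identityʳ (+ k)))

toℚ-mono-≤ : ∀ {a b} → a ℕ.≤ b → toℚ a ≤ toℚ b
toℚ-mono-≤ {a} {b} a≤b rewrite toℚ≡mkℚ a | toℚ≡mkℚ b =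
  *≤* (subst₂ ℤ._≤_ (sym (ℤ.*-identityʳ (+ a))) (sym (ℤ.*-identityʳ (+ b))) (ℤ.+≤+ a≤b))

1/k*k≡1 : ∀ k .{{_ : NonZero k}} → (+ 1) / k * toℚ k ≡ 1ℚ
1/k*k≡1 (suc k) rewrite normalize-coprime (Coprime.1-coprimeTo (suc k)) | toℚ≡mkℚ (suc k) =
  *-inverseˡ (mkℚ (+ suc k) 0 (Coprime.sym (Coprime.1-coprimeTo (suc k))))

x∈p─q⇒x∉q : ∀ (p q : Subset n) → x ∈ p ─ q → x ∉ q
x∈p─q⇒x∉q (inside ∷ p) (outside ∷ q) here ()
x∈p─q⇒x∉q (_ ∷ p) (_ ∷ q) (there x∈p─q) (there x∈q) = x∈p─q⇒x∉q p q x∈p─q x∈q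

x∈p-y⁻ : x ∈ p ∖ y → x ∈ p × x ≢ y
x∈p-y⁻ {p = p} {y = y} x∈p-y = p─q⊆p p ⁅ y ⁆ x∈p-y , λ { refl → x∈p─q⇒x∉q p ⁅ y ⁆ x∈p-y (x∈⁅x⁆ y) }

∪-lub : p ⊆ r → q ⊆ r → p ∪ q ⊆ r
∪-lub {p = p} {q = q} p⊆r q⊆r x∈p∪q = [ p⊆r , q⊆r ] (x∈p∪q⁻ p q x∈p∪q)

x∈p⇒⁅x⁆⊆p : x ∈ p → ⁅ x ⁆ ⊆ p
x∈p⇒⁅x⁆⊆p {x = x} x∈p y∈⁅x⁆ = subst (_∈ _) (sym (x∈⁅y⁆⇒x≡y x y∈⁅x⁆)) x∈p

p⊆p-x∪⁅x⁆ : ∀ (p : Subset n) x → p ⊆ (p ∖ x) ∪ ⁅ x ⁆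
p⊆p-x∪⁅x⁆ p x {y} y∈p with y ≟ x
... | yes refl = q⊆p∪q (p ∖ x) ⁅ x ⁆ (x∈⁅x⁆ x)
... | no  y≢x  = p⊆p∪q ⁅ x ⁆ (x∈p∧x≢y⇒x∈p-y y∈p y≢x)

x∈p⇒p-x∪⁅x⁆≡p : x ∈ p → (p ∖ x) ∪ ⁅ x ⁆ ≡ p
x∈p⇒p-x∪⁅x⁆≡p {x = x} {p = p} x∈p =
  ⊆-antisym (∪-lub (p─q⊆p p ⁅ x ⁆) (x∈p⇒⁅x⁆⊆p x∈p)) (p⊆p-x∪⁅x⁆ p x)

x∈p⇒p∪⁅x⁆≡p : x ∈ p → p ∪ ⁅ x ⁆ ≡ p
x∈p⇒p∪⁅x⁆≡p {x = x} x∈p = ⊆-antisym (∪-lub ⊆-refl (x∈p⇒⁅x⁆⊆p x∈p)) (p⊆p∪q ⁅ x ⁆)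

x≢y⇒p∪⁅x⁆-y≡p-y∪⁅x⁆ : x ≢ y → (p ∪ ⁅ x ⁆) ∖ y ≡ (p ∖ y) ∪ ⁅ x ⁆
x≢y⇒p∪⁅x⁆-y≡p-y∪⁅x⁆ {x = x} {y = y} {p = p} x≢y = ⊆-antisym forward backward
  where
  forward : (p ∪ ⁅ x ⁆) ∖ y ⊆ (p ∖ y) ∪ ⁅ x ⁆
  forward z∈ with x∈p-y⁻ z∈
  ... | z∈p∪⁅x⁆ , z≢y with x∈p∪q⁻ p ⁅ x ⁆ z∈p∪⁅x⁆
  ...   | inj₁ z∈p   = p⊆p∪q ⁅ x ⁆ (x∈p∧x≢y⇒x∈p-y z∈p z≢y)
  ...   | inj₂ z∈⁅x⁆ = q⊆p∪q (p ∖ y) ⁅ x ⁆ z∈⁅x⁆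
  backward : (p ∖ y) ∪ ⁅ x ⁆ ⊆ (p ∪ ⁅ x ⁆) ∖ y
  backward = ∪-lub (λ z∈ → let z∈p , z≢y = x∈p-y⁻ z∈ in x∈p∧x≢y⇒x∈p-y (p⊆p∪q ⁅ x ⁆ z∈p) z≢y)
                   (x∈p⇒⁅x⁆⊆p (x∈p∧x≢y⇒x∈p-y (q⊆p∪q p ⁅ x ⁆ (x∈⁅x⁆ x)) x≢y))

p⊆q⇒p∪r∪q≡q∪r : p ⊆ q → (p ∪ r) ∪ q ≡ q ∪ r
p⊆q⇒p∪r∪q≡q∪r {p = p} {q = q} {r = r} p⊆q = ⊆-antisym
  (∪-lub (∪-lub (p⊆p∪q r ∘ p⊆q) (q⊆p∪q q r)) (p⊆p∪q r))
  (∪-lub (q⊆p∪q (p ∪ r) q) (p⊆p∪q q ∘ q⊆p∪q p r))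

p⊆q∧x∉q⇒p∪⁅x⁆∩q≡p : p ⊆ q → x ∉ q → (p ∪ ⁅ x ⁆) ∩ q ≡ p
p⊆q∧x∉q⇒p∪⁅x⁆∩q≡p {p = p} {q = q} {x = x} p⊆q x∉q =
  ⊆-antisym forward (λ z∈p → x∈p∩q⁺ (p⊆p∪q ⁅ x ⁆ z∈p , p⊆q z∈p))
  where
  forward : (p ∪ ⁅ x ⁆) ∩ q ⊆ p
  forward z∈ with x∈p∩q⁻ (p ∪ ⁅ x ⁆) q z∈
  ... | z∈p∪⁅x⁆ , z∈q with x∈p∪q⁻ p ⁅ x ⁆ z∈p∪⁅x⁆
  ...   | inj₁ z∈p   = z∈p
  ...   | inj₂ z∈⁅x⁆ with refl ← x∈⁅y⁆⇒x≡y x z∈⁅x⁆ = contradiction z∈q x∉q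

x∈p⇒∣p∣≡1+∣p-x∣ : x ∈ p → ∣ p ∣ ≡ suc ∣ p ∖ x ∣
x∈p⇒∣p∣≡1+∣p-x∣ {p = inside  ∷ p} here          = cong suc (sym (cong ∣_∣ (p─⊥≡p p)))
x∈p⇒∣p∣≡1+∣p-x∣ {p = inside  ∷ p} (there x∈p) = cong suc (x∈p⇒∣p∣≡1+∣p-x∣ x∈p)
x∈p⇒∣p∣≡1+∣p-x∣ {p = outside ∷ p} (there x∈p) = x∈p⇒∣p∣≡1+∣p-x∣ x∈p

x∉p⇒∣p∣<∣p∪⁅x⁆∣ : x ∉ p → ∣ p ∣ ℕ.< ∣ p ∪ ⁅ x ⁆ ∣
x∉p⇒∣p∣<∣p∪⁅x⁆∣ {x = x} {p = p} x∉p = p⊂q⇒∣p∣<∣q∣ (p⊆p∪q ⁅ x ⁆ , x , q⊆p∪q p ⁅ x ⁆ (x∈⁅x⁆ x) , x∉p)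

x∉p∧y∈p⇒∣p∣≤∣p∪⁅x⁆-y∣ : x ∉ p → y ∈ p → ∣ p ∣ ℕ.≤ ∣ (p ∪ ⁅ x ⁆) ∖ y ∣
x∉p∧y∈p⇒∣p∣≤∣p∪⁅x⁆-y∣ {x = x} {p = p} {y = y} x∉p y∈p = begin
  ∣ p ∣                   ≡⟨ x∈p⇒∣p∣≡1+∣p-x∣ y∈p ⟩
  suc ∣ p ∖ y ∣           ≤⟨ x∉p⇒∣p∣<∣p∪⁅x⁆∣ (x∉p ∘ proj₁ ∘ x∈p-y⁻) ⟩
  ∣ (p ∖ y) ∪ ⁅ x ⁆ ∣     ≡⟨ cong ∣_∣ (x≢y⇒p∪⁅x⁆-y≡p-y∪⁅x⁆ {p = p} (λ { refl → x∉p y∈p })) ⟨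
  ∣ (p ∪ ⁅ x ⁆) ∖ y ∣     ∎
  where open ℕ.≤-Reasoning

removal-induction : ∀ {ℓ} (P : Subset n → Set ℓ) → P ⊥ → (∀ p x → x ∈ p → P (p ∖ x) → P p) → ∀ p → P p
removal-induction P P⊥ step p = go (suc ∣ p ∣) p ℕ.≤-refl
  where
  go : ∀ k p → ∣ p ∣ ℕ.< k → P p
  go (suc k) p ∣p∣<1+k with nonempty? p
  ... | no  p-empty   = subst P (sym (Empty-unique p-empty)) P⊥
  ... | yes (x , x∈p) =
    step p x x∈p (go k (p ∖ x) (ℕ.<-≤-trans (x∈p⇒∣p-x∣<∣p∣ x∈p) (ℕ.s≤s⁻¹ ∣p∣<1+k)))

Vanishes : SetFn n → Set
Vanishes {n} f = (A : Subset n) → f A ≤ 0ℚ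

module _ {n} (f : SetFn n) where

  marg-nonNeg : Monotone f → ∀ x A → 0ℚ ≤ marg f x A
  marg-nonNeg mono x A = p≤q⇒0≤q-p (mono A (A ∪ ⁅ x ⁆) (p⊆p∪q ⁅ x ⁆))

  x∈A⇒marg≡f[A]-f[A∖x] : ∀ {x A} → x ∈ A → marg f x (A ∖ x) ≡ f A - f (A ∖ x)
  x∈A⇒marg≡f[A]-f[A∖x] {x} {A} x∈A = cong (λ B → f B - f (A ∖ x)) (x∈p⇒p-x∪⁅x⁆≡p x∈A)

  subadditive : NonNegative f → Submodular f → ∀ A B → f (A ∪ B) ≤ f A + f B
  subadditive nonNeg submod A B = ≤-trans (p≤p+q (f (A ∪ B)) (nonNeg (A ∩ B))) (submod A B)

  marg-antitone : Submodular f → ∀ {x A B} → A ⊆ B → x ∉ B → marg f x B ≤ marg f x A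
  marg-antitone submod {x} {A} {B} A⊆B x∉B = a+d≤c+b⇒a-b≤c-d (f (B ∪ ⁅ x ⁆)) (f B) (f (A ∪ ⁅ x ⁆)) (f A)
    (subst₂ (λ C D → f C + f D ≤ f (A ∪ ⁅ x ⁆) + f B)
            (p⊆q⇒p∪r∪q≡q∪r A⊆B) (p⊆q∧x∉q⇒p∪⁅x⁆∩q≡p A⊆B x∉B) (submod (A ∪ ⁅ x ⁆) B))

  RemovalGains≥ : ℚ → Subset n → Set
  RemovalGains≥ m A = ∀ z → z ∈ A → m ≤ marg f z (A ∖ z)

  RemovalGains≥-∖ : Submodular f → ∀ {m A} x → RemovalGains≥ m A → RemovalGains≥ m (A ∖ x)
  RemovalGains≥-∖ submod {m} {A} x m≤ z z∈A-x = ≤-trans (m≤ z (proj₁ (x∈p-y⁻ z∈A-x)))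
    (marg-antitone submod (⊆-trans (⊆-reflexive (p─x─y≡p─y─x A x z)) (p─q⊆p (A ∖ z) ⁅ x ⁆))
                          (λ z∈A-z → proj₂ (x∈p-y⁻ z∈A-z) refl))

  ∣A∣*m≤f[A]-f[⊥] : Submodular f → ∀ {m} A → RemovalGains≥ m A → toℚ ∣ A ∣ * m ≤ f A - f ⊥
  ∣A∣*m≤f[A]-f[⊥] submod {m} = removal-induction (λ A → RemovalGains≥ m A → Bound A) base step
    where
    Bound : Subset n → Set
    Bound A = toℚ ∣ A ∣ * m ≤ f A - f ⊥

    base : RemovalGains≥ m ⊥ → Bound ⊥
    base _ = ≤-reflexive (begin
      toℚ ∣ ⊥ {n} ∣ * m   ≡⟨ cong (λ k → toℚ k * m) (∣⊥∣≡0 n) ⟩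
      0ℚ * m              ≡⟨ *-zeroˡ m ⟩
      0ℚ                  ≡⟨ +-inverseʳ (f ⊥) ⟨
      f ⊥ - f ⊥           ∎)
      where open ≡-Reasoning

    step : ∀ A x → x ∈ A → (RemovalGains≥ m (A ∖ x) → Bound (A ∖ x)) → RemovalGains≥ m A → Bound A
    step A x x∈A ih m≤ = begin
      toℚ ∣ A ∣ * m                          ≡⟨ cong (λ k → toℚ k * m) (x∈p⇒∣p∣≡1+∣p-x∣ x∈A) ⟩
      toℚ (suc k) * m                        ≡⟨ cong (_* m) (toℚ-suc k) ⟩
      (1ℚ + toℚ k) * m                       ≡⟨ distrib (toℚ k) m ⟩
      m + toℚ k * m                          ≤⟨ +-mono-≤ m≤gain[x] (ih (RemovalGains≥-∖ submod x m≤)) ⟩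
      (f A - f (A ∖ x)) + (f (A ∖ x) - f ⊥)  ≡⟨ telescope (f A) (f (A ∖ x)) (f ⊥) ⟩
      f A - f ⊥                              ∎
      where
      open ≤-Reasoning
      k = ∣ A ∖ x ∣
      m≤gain[x] : m ≤ f A - f (A ∖ x)
      m≤gain[x] = subst (m ≤_) (x∈A⇒marg≡f[A]-f[A∖x] x∈A) (m≤ x x∈A)
      distrib : ∀ K m → (1ℚ + K) * m ≡ m + K * m
      distrib = solve 2 (λ K m → (con 1ℚ :+ K) :* m := m :+ K :* m) refl
      telescope : ∀ a b c → (a - b) + (b - c) ≡ a - c
      telescope = solve 3 (λ a b c → (a :- b) :+ (b :- c) := a :- c) refl

  vanishes-on-singletons⇒vanishes : NonNegative f → Submodular f →
    f ⊥ ≤ 0ℚ → (∀ z → f ⁅ z ⁆ ≤ 0ℚ) → Vanishes f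
  vanishes-on-singletons⇒vanishes nonNeg submod f⊥≤0 f⁅⁆≤0 = removal-induction _ f⊥≤0 step
    where
    step : ∀ A x → x ∈ A → f (A ∖ x) ≤ 0ℚ → f A ≤ 0ℚ
    step A x x∈A ih = subst (λ B → f B ≤ 0ℚ) (x∈p⇒p-x∪⁅x⁆≡p x∈A)
      (≤-trans (subadditive nonNeg submod (A ∖ x) ⁅ x ⁆) (+-mono-≤ ih (f⁅⁆≤0 x)))

module _ {n} {f : SetFn n} where

  greedy-k≤∣S∣ : ∀ {k S} → GreedyRun f k S → k ℕ.≤ ∣ S ∣
  greedy-k≤∣S∣ g-start                 = ℕ.z≤n
  greedy-k≤∣S∣ (g-step e run e∉S _) = ℕ.≤-trans (ℕ.s≤s (greedy-k≤∣S∣ run)) (x∉p⇒∣p∣<∣p∪⁅x⁆∣ e∉S)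

  greedy-f⁅z⁆≤f[S] : Monotone f → ∀ {k S} .{{_ : NonZero k}} → GreedyRun f k S → ∀ z → f ⁅ z ⁆ ≤ f S
  greedy-f⁅z⁆≤f[S] mono {{()}} g-start
  greedy-f⁅z⁆≤f[S] mono (g-step e g-start _ best) z =
    subst (λ A → f A ≤ f (⊥ ∪ ⁅ e ⁆)) (∪-identityˡ ⁅ z ⁆)
      (p-r≤q-r⇒p≤q (f (⊥ ∪ ⁅ z ⁆)) (f (⊥ ∪ ⁅ e ⁆)) (f ⊥) (best z ∉⊥))
  greedy-f⁅z⁆≤f[S] mono (g-step e run@(g-step _ _ _ _) _ _) z =
    ≤-trans (greedy-f⁅z⁆≤f[S] mono run z) (mono _ _ (p⊆p∪q ⁅ e ⁆))

module LocalSearch {n} {f : SetFn n} (nonNeg : NonNegative f) (mono : Monotone f) (submod : Submodular f)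
                   (ε : ℚ) (κ : ℕ) .{{_ : NonZero κ}} where

  c : ℚ
  c = (+ 1) / κ

  0<c : 0ℚ < c
  0<c = positive⁻¹ c {{normalize-pos 1 κ}}

  argmin-marg≤c*f[S] : ∀ {S y} → κ ℕ.≤ ∣ S ∣ → IsArgminRemoval f y S → marg f y (S ∖ y) ≤ c * f S
  argmin-marg≤c*f[S] {S} {y} κ≤∣S∣ (_ , argmin) = begin
    m                  ≡⟨ *-identityˡ m ⟨
    1ℚ * m             ≡⟨ cong (_* m) (1/k*k≡1 κ) ⟨
    c * toℚ κ * m      ≡⟨ *-assoc c (toℚ κ) m ⟩
    c * (toℚ κ * m)    ≤⟨ *-monoˡ-≤-nonNeg c {{nonNegative (<⇒≤ 0<c)}} κm≤f[S] ⟩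
    c * f S            ∎
    where
    open ≤-Reasoning
    m = marg f y (S ∖ y)
    0≤m = marg-nonNeg f mono y (S ∖ y)
    κm≤f[S] : toℚ κ * m ≤ f S
    κm≤f[S] = begin
      toℚ κ * m      ≤⟨ *-monoʳ-≤-nonNeg m {{nonNegative 0≤m}} (toℚ-mono-≤ κ≤∣S∣) ⟩
      toℚ ∣ S ∣ * m  ≤⟨ ∣A∣*m≤f[A]-f[⊥] f submod S argmin ⟩
      f S - f ⊥      ≤⟨ p-q≤p (f S) (nonNeg ⊥) ⟩
      f S            ∎

  swap-gain : ∀ {S x y} → κ ℕ.≤ ∣ S ∣ → x ∉ S → Improving f ε κ x S → IsArgminRemoval f y S →
              (1ℚ + ε * c) * f S ≤ f ((S ∪ ⁅ x ⁆) ∖ y)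
  swap-gain {S} {x} {y} κ≤∣S∣ x∉S improving argmin@(y∈S , _) = begin
    (1ℚ + ε * c) * f S                              ≡⟨ split ε c (f S) ⟩
    (1ℚ + ε) * c * f S + (f S - c * f S)            ≤⟨ +-mono-≤ gain loss ⟩
    (f S′ - f (S ∖ y)) + (f S - (f S - f (S ∖ y)))  ≡⟨ cancel (f S′) (f (S ∖ y)) (f S) ⟩
    f S′                                            ≡⟨ cong f (x≢y⇒p∪⁅x⁆-y≡p-y∪⁅x⁆ {p = S} x≢y) ⟨
    f ((S ∪ ⁅ x ⁆) ∖ y)                             ∎
    where
    open ≤-Reasoning
    S′ = (S ∖ y) ∪ ⁅ x ⁆
    x≢y : x ≢ y
    x≢y refl = x∉S y∈S
    split : ∀ e c F → (1ℚ + e * c) * F ≡ (1ℚ + e) * c * F + (F - c * F)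
    split = solve 3 (λ e c F → (con 1ℚ :+ e :* c) :* F := (con 1ℚ :+ e) :* c :* F :+ (F :- c :* F)) refl
    cancel : ∀ G D F → (G - D) + (F - (F - D)) ≡ G
    cancel = solve 3 (λ G D F → (G :- D) :+ (F :- (F :- D)) := G) refl
    gain : (1ℚ + ε) * c * f S ≤ f S′ - f (S ∖ y)
    gain = ≤-trans improving (marg-antitone f submod (p─q⊆p S ⁅ y ⁆) x∉S)
    loss : f S - c * f S ≤ f S - (f S - f (S ∖ y))
    loss = +-monoʳ-≤ (f S) (neg-antimono-≤
      (subst (_≤ c * f S) (x∈A⇒marg≡f[A]-f[A∖x] f y∈S) (argmin-marg≤c*f[S] κ≤∣S∣ argmin)))

  improving⇒x∉S : 0ℚ < ε → ∀ {S x} → 0ℚ < f S → Improving f ε κ x S → x ∉ S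
  improving⇒x∉S 0<ε {S} 0<f[S] improving x∈S = <-irrefl refl (<-≤-trans 0<gain gain≤0)
    where
    0<gain : 0ℚ < (1ℚ + ε) * c * f S
    0<gain = 0<p∧0<q⇒0<p*q (0<p∧0<q⇒0<p*q (+-mono-≤-< (nonNegative⁻¹ 1ℚ) 0<ε) 0<c) 0<f[S]
    gain≤0 : (1ℚ + ε) * c * f S ≤ 0ℚ
    gain≤0 = subst (_ ≤_) (trans (cong (λ A → f A - f S) (x∈p⇒p∪⁅x⁆≡p x∈S)) (+-inverseʳ (f S))) improving

  -- A greedy output of value 0 may be shrunk by swaps with x ∈ S; this only happens when f ≡ 0.
  LSInvariant : Subset n → Set
  LSInvariant S = Vanishes f ⊎ (0ℚ < f S × κ ℕ.≤ ∣ S ∣)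

  greedy-invariant : ∀ {S} → GreedyRun f κ S → LSInvariant S
  greedy-invariant {S} run with f S ≤? 0ℚ
  ... | yes f[S]≤0 = inj₁ (vanishes-on-singletons⇒vanishes f nonNeg submod
                             (≤-trans (mono ⊥ S ⊥⊆) f[S]≤0)
                             (λ z → ≤-trans (greedy-f⁅z⁆≤f[S] mono run z) f[S]≤0))
  ... | no  f[S]≰0 = inj₂ (≰⇒> f[S]≰0 , greedy-k≤∣S∣ run)

  swap-invariant : 0ℚ < ε → ∀ {S x y} → LSInvariant S → Improving f ε κ x S → IsArgminRemoval f y S →
                   LSInvariant ((S ∪ ⁅ x ⁆) ∖ y)
  swap-invariant 0<ε (inj₁ vanishes) _ _ = inj₁ vanishes
  swap-invariant 0<ε (inj₂ (0<f[S] , κ≤∣S∣)) improving argmin@(y∈S , _) =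
    inj₂ ( <-≤-trans 0<f[S] (≤-trans f[S]≤gain (swap-gain κ≤∣S∣ x∉S improving argmin))
         , ℕ.≤-trans κ≤∣S∣ (x∉p∧y∈p⇒∣p∣≤∣p∪⁅x⁆-y∣ x∉S y∈S))
    where
    x∉S = improving⇒x∉S 0<ε 0<f[S] improving
    f[S]≤gain = p≤[1+q]*p (<⇒≤ 0<f[S]) (<⇒≤ (0<p∧0<q⇒0<p*q 0<ε 0<c))

  ls-invariant : 0ℚ < ε → ∀ {S} → LSState f ε κ S → LSInvariant S
  ls-invariant 0<ε (ls-init run)                      = greedy-invariant run
  ls-invariant 0<ε (ls-swap x y state improving argmin) =
    swap-invariant 0<ε (ls-invariant 0<ε state) improving argmin

lemma10 : (n : ℕ) (f : SetFn n) → NonNegative f → Monotone f → Submodular f →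
    (ε : ℚ) → 0ℚ < ε → (κ : ℕ) .{{_ : ℕ.NonZero κ}} →
    (S : Subset n) → LSState f ε κ S →
    (x y : Fin n) → Improving f ε κ x S → IsArgminRemoval f y S →
    (1ℚ + ε * ((+ 1) / κ)) * f S ≤ f ((S ∪ ⁅ x ⁆) ∖ y)
lemma10 n f nonNeg mono submod ε 0<ε κ S state x y improving argmin =
  [ vanishing-case , positive-case ] (ls-invariant 0<ε state)
  where
  open LocalSearch nonNeg mono submod ε κ
  vanishing-case : Vanishes f → (1ℚ + ε * c) * f S ≤ f ((S ∪ ⁅ x ⁆) ∖ y)
  vanishing-case vanishes = subst (_≤ f ((S ∪ ⁅ x ⁆) ∖ y)) (sym lhs≡0) (nonNeg _)
    where
    lhs≡0 : (1ℚ + ε * c) * f S ≡ 0ℚ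
    lhs≡0 = trans (cong ((1ℚ + ε * c) *_) (≤-antisym (vanishes S) (nonNeg S))) (*-zeroʳ (1ℚ + ε * c))
  positive-case : 0ℚ < f S × κ ℕ.≤ ∣ S ∣ → (1ℚ + ε * c) * f S ≤ f ((S ∪ ⁅ x ⁆) ∖ y)
  positive-case (0<f[S] , κ≤∣S∣) = swap-gain κ≤∣S∣ (improving⇒x∉S 0<ε 0<f[S] improving) improving argmin
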